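{- Let $P$ be a lattice polygon boxed with respect to the unit square $Q=[0,1]^2$, so that $(P\cap\mathbb{Z}^2)\setminus Q=\{v_1,v_2\}$ with $v_1=(a_1,\lambda^1_y)$, $v_2=(\lambda^2_x,a_2)$, $a_1,a_2\in\mathbb{Z}\setminus\{0,1\}$, $\lambda^1_y,\lambda^2_x\in\{0,1\}$. Suppose that $P$ intersects the edge $Q\cap\{x=0\}$ of $Q$, that $P$ contains neither $(1,0)$ nor $(1,1)$, and that $v_2=(1,a_2)$. Then $a_2\in\{ -2,-1,2,3\}$.
   Context: An affine functional $f$ is integer if $f(\mathbb{Z}^2)\subseteq\mathbb{Z}$. Width of $P$: minimum over non-constant integer affine $f$ of $\max_P f-\min_P f$. A lattice polygon $P$ of width larger than one is boxed with respect to $[0,1]^2=\bigcap_i f_i^{ -1}([0,1])$, with $f_1=x,f_2=y$, if $(P\cap\mathbb{Z}^2)\setminus[0,1]^2=\{v_1,v_2\}$ with $f_i(v_j)\notin\{0,1\}$ if and only if $i=j$. -}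

module Defs where

open import Data.Nat using (ℕ)
open import Data.Integer as ℤ using (ℤ; +_)
open import Data.Rational as ℚ using (ℚ; 0ℚ; 1ℚ; _/_)
open import Data.Fin using (Fin; zero; suc)
open import Data.Vec using (Vec; lookup)
open import Data.Product using (_×_; _,_; proj₁; proj₂; Σ; ∃)
open import Data.Sum using (_⊎_)
open import Relation.Binary.PropositionalEquality using (_≡_)
open import Relation.Nullary using (¬_)

Pt : Set
Pt = ℤ × ℤ

QPt : Set
QPt = ℚ × ℚ

toℚ : ℤ → ℚ
toℚ z = z / 1

embed : Pt → QPt
embed (a , b) = toℚ a , toℚ b

sumFin : ∀ {n} → (Fin n → ℚ) → ℚ
sumFin {ℕ.zero} f = 0ℚ
sumFin {ℕ.suc n} f = f zero ℚ.+ sumFin (λ i → f (suc i))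

-- A lattice polygon is given as the convex hull of finitely many lattice
-- points (the list of vertices V).
InConv : ∀ {n} → Vec Pt n → QPt → Set
InConv {n} V p =
  Σ (Fin n → ℚ) λ w →
    (∀ i → 0ℚ ℚ.≤ w i) ×
    sumFin w ≡ 1ℚ ×
    sumFin (λ i → w i ℚ.* toℚ (proj₁ (lookup V i))) ≡ proj₁ p ×
    sumFin (λ i → w i ℚ.* toℚ (proj₂ (lookup V i))) ≡ proj₂ p

-- integer affine functional f(x,y) = a x + b y + c with a b c ∈ ℤ
-- (exactly the affine functionals with f(ℤ²) ⊆ ℤ)
record IntAffine : Set where
  constructor affine
  field
    a b c : ℤ

evalQ : IntAffine → QPt → ℚ
evalQ (affine a b c) (x , y) = toℚ a ℚ.* x ℚ.+ toℚ b ℚ.* y ℚ.+ toℚ c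

NonConstant : IntAffine → Set
NonConstant (affine a b c) = ¬ (a ≡ + 0 × b ≡ + 0)

-- width(P) > 1 : for every non-constant integer affine f,
-- max_P f - min_P f > 1, i.e. there are points p q of P with f p - f q > 1
-- (max/min are attained at vertices, which are lattice, hence rational points)
WidthGt1 : ∀ {n} → Vec Pt n → Set
WidthGt1 V = ∀ (f : IntAffine) → NonConstant f →
  ∃ λ p → ∃ λ q → InConv V p × InConv V q × 1ℚ ℚ.< evalQ f p ℚ.- evalQ f q

Is01 : ℤ → Set
Is01 z = z ≡ + 0 ⊎ z ≡ + 1

InUnitSquare : Pt → Set
InUnitSquare (x , y) = Is01 x × Is01 y

-- P = conv(V) is boxed w.r.t. [0,1]² with outer points v1, v2:
-- width > 1, (P ∩ ℤ²) \ [0,1]² = {v1, v2}, and f_i(v_j) ∉ {0,1} iff i = j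
-- (f_1 = x, f_2 = y).
Boxed : ∀ {n} → Vec Pt n → Pt → Pt → Set
Boxed V v1 v2 =
  WidthGt1 V ×
  (∀ (z : Pt) → (InConv V (embed z) × ¬ InUnitSquare z) → (z ≡ v1 ⊎ z ≡ v2)) ×
  InConv V (embed v1) × ¬ InUnitSquare v1 ×
  InConv V (embed v2) × ¬ InUnitSquare v2 ×
  ¬ Is01 (proj₁ v1) × Is01 (proj₂ v1) ×
  Is01 (proj₁ v2) × ¬ Is01 (proj₂ v2)

module Submission where

-- Let p = (0,t) be a point of P on the edge x = 0 of Q, and let
-- v₁ = (a₁,λ), v₂ = (1,a₂) be the two outer lattice points of P.  Since
-- a₁ ∉ {0,1} we have a₁ ≥ 1 or a₁ ≤ -1; if a₂ ∉ {-2,-1,2,3} we moreover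
-- have a₂ ≥ 4 or a₂ ≤ -3.  In each of the four resulting cases an explicit
-- nonnegative combination of p, v₁, v₂ exhibits a lattice point of P that
-- is forbidden:
--   a₁ ≥ 1, a₂ ≥ 4  : (1,1) ∈ P,          a₁ ≥ 1, a₂ ≤ -3  : (1,0) ∈ P,
--   a₁ ≤ -1, a₂ ≥ 4 : (0,2) ∈ P,          a₁ ≤ -1, a₂ ≤ -3 : (0,-1) ∈ P,
-- where the last two points lie outside Q but differ from v₁ (as a₁ ≠ 0)
-- and from v₂ (as 1 ≠ 0).

open import Defs
open import Data.Nat using (ℕ; z≤n; s≤s)
open import Data.Integer as ℤ using (ℤ; +_; -[1+_])
import Data.Integer.Properties as ℤ
open import Data.Integer.GCD using (gcd; gcd-zeroʳ)
open import Data.Rational as ℚ using (ℚ; 0ℚ; 1ℚ; _+_; _*_; _-_; -_; 1/_; ↥_; ↧_)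
open import Data.Rational.Properties as ℚ
  using (+-*-commutativeRing; _≟_; ↥-/; ↧-/; *-inverseˡ; *-identityˡ; *-assoc)
open import Data.Fin using (Fin; zero; suc)
open import Data.Vec using (Vec; lookup)
open import Data.List using (_∷_; [])
open import Data.Product using (_×_; _,_; proj₁; proj₂; ∃)
open import Data.Sum using (_⊎_; inj₁; inj₂)
open import Data.Empty using (⊥-elim)
open import Level using (0ℓ)
open import Relation.Binary.PropositionalEquality
open import Relation.Nullary using (¬_; dec⇒maybe)
open import Tactic.RingSolver using (solve)
import Tactic.RingSolver.Core.AlmostCommutativeRing as ACR

ℚ-ring : ACR.AlmostCommutativeRing 0ℓ 0ℓ
ℚ-ring = ACR.fromCommutativeRing +-*-commutativeRing (λ x → dec⇒maybe (0ℚ ≟ x))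

sumFin-cong : ∀ {n} {f g : Fin n → ℚ} → (∀ i → f i ≡ g i) → sumFin f ≡ sumFin g
sumFin-cong {ℕ.zero}  f≗g = refl
sumFin-cong {ℕ.suc n} f≗g = cong₂ _+_ (f≗g zero) (sumFin-cong (λ i → f≗g (suc i)))

sumFin-+ : ∀ {n} (f g : Fin n → ℚ) → sumFin (λ i → f i + g i) ≡ sumFin f + sumFin g
sumFin-+ {ℕ.zero}  f g = refl
sumFin-+ {ℕ.suc n} f g = begin
  f zero + g zero + sumFin (λ i → f (suc i) + g (suc i))
    ≡⟨ cong (λ s → f zero + g zero + s) (sumFin-+ (λ i → f (suc i)) (λ i → g (suc i))) ⟩
  f zero + g zero + (F + G)
    ≡⟨ interchange (f zero) (g zero) F G ⟩
  f zero + F + (g zero + G) ∎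
  where
  open ≡-Reasoning
  interchange : ∀ a b c d → a + b + (c + d) ≡ a + c + (b + d)
  interchange a b c d = solve (a ∷ b ∷ c ∷ d ∷ []) ℚ-ring
  F = sumFin (λ i → f (suc i))
  G = sumFin (λ i → g (suc i))

sumFin-*ˡ : ∀ {n} (c : ℚ) (f : Fin n → ℚ) → sumFin (λ i → c * f i) ≡ c * sumFin f
sumFin-*ˡ {ℕ.zero}  c f = sym (ℚ.*-zeroʳ c)
sumFin-*ˡ {ℕ.suc n} c f = begin
  c * f zero + sumFin (λ i → c * f (suc i))
    ≡⟨ cong (λ s → c * f zero + s) (sumFin-*ˡ c (λ i → f (suc i))) ⟩
  c * f zero + c * F
    ≡⟨ ℚ.*-distribˡ-+ c (f zero) F ⟨
  c * (f zero + F) ∎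
  where
  open ≡-Reasoning
  F = sumFin (λ i → f (suc i))

sumFin-combine : ∀ {n} (c α β γ : ℚ) (f g h : Fin n → ℚ) →
  sumFin (λ i → c * (α * f i + β * g i + γ * h i))
    ≡ c * (α * sumFin f + β * sumFin g + γ * sumFin h)
sumFin-combine c α β γ f g h = begin
  sumFin (λ i → c * (α * f i + β * g i + γ * h i))
    ≡⟨ sumFin-*ˡ c (λ i → α * f i + β * g i + γ * h i) ⟩
  c * sumFin (λ i → α * f i + β * g i + γ * h i)
    ≡⟨ cong (c *_) (trans (sumFin-+ (λ i → α * f i + β * g i) (λ i → γ * h i))
                          (cong₂ _+_ (sumFin-+ (λ i → α * f i) (λ i → β * g i)) refl)) ⟩
  c * (sumFin (λ i → α * f i) + sumFin (λ i → β * g i) + sumFin (λ i → γ * h i))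
    ≡⟨ cong (c *_) (cong₂ _+_ (cong₂ _+_ (sumFin-*ˡ α f) (sumFin-*ˡ β g)) (sumFin-*ˡ γ h)) ⟩
  c * (α * sumFin f + β * sumFin g + γ * sumFin h) ∎
  where open ≡-Reasoning

0≤+ : ∀ {p q} → 0ℚ ℚ.≤ p → 0ℚ ℚ.≤ q → 0ℚ ℚ.≤ p + q
0≤+ = ℚ.+-mono-≤

0≤* : ∀ {p q} → 0ℚ ℚ.≤ p → 0ℚ ℚ.≤ q → 0ℚ ℚ.≤ p * q
0≤* {p} {q} 0≤p 0≤q = ℚ.nonNegative⁻¹ (p * q)
  {{ℚ.nonNeg*nonNeg⇒nonNeg p {{ℚ.nonNegative 0≤p}} q {{ℚ.nonNegative 0≤q}}}}

0≤1 : 0ℚ ℚ.≤ 1ℚ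
0≤1 = ℚ.*≤* (ℤ.+≤+ z≤n)

0<1 : 0ℚ ℚ.< 1ℚ
0<1 = ℚ.*<* (ℤ.+<+ (s≤s z≤n))

0≤- : ∀ {p q} → p ℚ.≤ q → 0ℚ ℚ.≤ q - p
0≤- {p} {q} p≤q = subst (ℚ._≤ q - p) (ℚ.+-inverseʳ p) (ℚ.+-monoˡ-≤ (- p) p≤q)

0<- : ∀ {p q} → p ℚ.< q → 0ℚ ℚ.< q - p
0<- {p} {q} p<q = subst (ℚ._< q - p) (ℚ.+-inverseʳ p) (ℚ.+-monoˡ-< (- p) p<q)

0<-middle : ∀ {α β γ} → 0ℚ ℚ.≤ α → 0ℚ ℚ.< β → 0ℚ ℚ.≤ γ → 0ℚ ℚ.< α + β + γ
0<-middle 0≤α 0<β 0≤γ = ℚ.+-mono-<-≤ (ℚ.+-mono-≤-< 0≤α 0<β) 0≤γ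

convexCombination₃ : ∀ {n} (V : Vec Pt n) {x₁ y₁ x₂ y₂ x₃ y₃ x y : ℚ}
  (α β γ : ℚ) → 0ℚ ℚ.≤ α → 0ℚ ℚ.≤ β → 0ℚ ℚ.≤ γ → 0ℚ ℚ.< α + β + γ →
  InConv V (x₁ , y₁) → InConv V (x₂ , y₂) → InConv V (x₃ , y₃) →
  (α + β + γ) * x ≡ α * x₁ + β * x₂ + γ * x₃ →
  (α + β + γ) * y ≡ α * y₁ + β * y₂ + γ * y₃ →
  InConv V (x , y)
convexCombination₃ V α β γ 0≤α 0≤β 0≤γ 0<D
  (w₁ , w₁≥0 , Σw₁ , Σw₁x , Σw₁y) (w₂ , w₂≥0 , Σw₂ , Σw₂x , Σw₂y)
  (w₃ , w₃≥0 , Σw₃ , Σw₃x , Σw₃y) Dx Dy =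
  w , w≥0 , Σw ,
  moment (λ i → toℚ (proj₁ (lookup V i))) Σw₁x Σw₂x Σw₃x Dx ,
  moment (λ i → toℚ (proj₂ (lookup V i))) Σw₁y Σw₂y Σw₃y Dy
  where
  open ≡-Reasoning
  D = α + β + γ
  instance
    D-nonZero : ℚ.NonZero D
    D-nonZero = ℚ.pos⇒nonZero D {{ℚ.positive 0<D}}

  c = 1/ D

  w : Fin _ → ℚ
  w i = c * (α * w₁ i + β * w₂ i + γ * w₃ i)

  w≥0 : ∀ i → 0ℚ ℚ.≤ w i
  w≥0 i = 0≤* (ℚ.nonNegative⁻¹ c {{ℚ.pos⇒nonNeg c {{ℚ.1/pos⇒pos D {{ℚ.positive 0<D}}}}}})
              (0≤+ (0≤+ (0≤* 0≤α (w₁≥0 i)) (0≤* 0≤β (w₂≥0 i))) (0≤* 0≤γ (w₃≥0 i)))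

  distribute : ∀ c a b d X →
    c * (α * a + β * b + γ * d) * X ≡ c * (α * (a * X) + β * (b * X) + γ * (d * X))
  distribute c a b d X = solve (c ∷ α ∷ β ∷ γ ∷ a ∷ b ∷ d ∷ X ∷ []) ℚ-ring

  moment : ∀ (X : Fin _ → ℚ) {m₁ m₂ m₃ z : ℚ} →
    sumFin (λ i → w₁ i * X i) ≡ m₁ → sumFin (λ i → w₂ i * X i) ≡ m₂ →
    sumFin (λ i → w₃ i * X i) ≡ m₃ → D * z ≡ α * m₁ + β * m₂ + γ * m₃ →
    sumFin (λ i → w i * X i) ≡ z
  moment X {m₁} {m₂} {m₃} {z} e₁ e₂ e₃ Dz = begin
    sumFin (λ i → w i * X i)
      ≡⟨ sumFin-cong (λ i → distribute c (w₁ i) (w₂ i) (w₃ i) (X i)) ⟩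
    sumFin (λ i → c * (α * (w₁ i * X i) + β * (w₂ i * X i) + γ * (w₃ i * X i)))
      ≡⟨ sumFin-combine c α β γ (λ i → w₁ i * X i) (λ i → w₂ i * X i) (λ i → w₃ i * X i) ⟩
    c * (α * sumFin (λ i → w₁ i * X i) + β * sumFin (λ i → w₂ i * X i)
           + γ * sumFin (λ i → w₃ i * X i))
      ≡⟨ cong (c *_) (cong₂ _+_ (cong₂ (λ a b → α * a + β * b) e₁ e₂) (cong (γ *_) e₃)) ⟩
    c * (α * m₁ + β * m₂ + γ * m₃)
      ≡⟨ cong (c *_) (sym Dz) ⟩
    c * (D * z)
      ≡⟨ sym (*-assoc c D z) ⟩
    c * D * z
      ≡⟨ cong (_* z) (*-inverseˡ D) ⟩
    1ℚ * z
      ≡⟨ *-identityˡ z ⟩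
    z ∎

  -- the total weight is the moment of the constant function 1
  times1 : ∀ (v : Fin _ → ℚ) → sumFin v ≡ 1ℚ → sumFin (λ i → v i * 1ℚ) ≡ 1ℚ
  times1 v Σv = trans (sumFin-cong (λ i → ℚ.*-identityʳ (v i))) Σv

  D1 : (α + β + γ) * 1ℚ ≡ α * 1ℚ + β * 1ℚ + γ * 1ℚ
  D1 = solve (α ∷ β ∷ γ ∷ []) ℚ-ring

  Σw : sumFin w ≡ 1ℚ
  Σw = trans (sumFin-cong (λ i → sym (ℚ.*-identityʳ (w i))))
             (moment (λ _ → 1ℚ) (times1 w₁ Σw₁) (times1 w₂ Σw₂) (times1 w₃ Σw₃) D1)

↥toℚ : ∀ z → ↥ toℚ z ≡ z
↥toℚ z = begin
  ↥ toℚ z                  ≡⟨ ℤ.*-identityʳ (↥ toℚ z) ⟨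
  ↥ toℚ z ℤ.* + 1          ≡⟨ cong (↥ toℚ z ℤ.*_) (gcd-zeroʳ z) ⟨
  ↥ toℚ z ℤ.* gcd z (+ 1)  ≡⟨ ↥-/ z 1 ⟩
  z                        ∎
  where open ≡-Reasoning

↧toℚ : ∀ z → ↧ toℚ z ≡ + 1
↧toℚ z = begin
  ↧ toℚ z                  ≡⟨ ℤ.*-identityʳ (↧ toℚ z) ⟨
  ↧ toℚ z ℤ.* + 1          ≡⟨ cong (↧ toℚ z ℤ.*_) (gcd-zeroʳ z) ⟨
  ↧ toℚ z ℤ.* gcd z (+ 1)  ≡⟨ ↧-/ z 1 ⟩
  + 1                      ∎
  where open ≡-Reasoning

cross-toℚ : ∀ m n → ↥ toℚ m ℤ.* ↧ toℚ n ≡ m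
cross-toℚ m n = trans (cong₂ ℤ._*_ (↥toℚ m) (↧toℚ n)) (ℤ.*-identityʳ m)

toℚ-mono-≤ : ∀ {m n} → m ℤ.≤ n → toℚ m ℚ.≤ toℚ n
toℚ-mono-≤ {m} {n} m≤n = ℚ.*≤* (subst₂ ℤ._≤_ (sym (cross-toℚ m n)) (sym (cross-toℚ n m)) m≤n)

toℚ-mono-< : ∀ {m n} → m ℤ.< n → toℚ m ℚ.< toℚ n
toℚ-mono-< {m} {n} m<n = ℚ.*<* (subst₂ ℤ._<_ (sym (cross-toℚ m n)) (sym (cross-toℚ n m)) m<n)

Is01⇒bounds : ∀ {z} → Is01 z → + 0 ℤ.≤ z × z ℤ.≤ + 1
Is01⇒bounds (inj₁ refl) = ℤ.≤-refl , ℤ.+≤+ z≤n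
Is01⇒bounds (inj₂ refl) = ℤ.+≤+ z≤n , ℤ.≤-refl

nonzero-sign : ∀ {a} → a ≢ + 0 → + 1 ℤ.≤ a ⊎ a ℤ.≤ -[1+ 0 ]
nonzero-sign {+ 0}          a≢0 = ⊥-elim (a≢0 refl)
nonzero-sign {+ ℕ.suc n}    _   = inj₁ (ℤ.+≤+ (s≤s z≤n))
nonzero-sign { -[1+ n ]}    _   = inj₂ (ℤ.-≤- z≤n)

outside01-cases : ∀ a → ¬ Is01 a →
  (a ≡ -[1+ 1 ] ⊎ a ≡ -[1+ 0 ] ⊎ a ≡ + 2 ⊎ a ≡ + 3) ⊎ (+ 4 ℤ.≤ a ⊎ a ℤ.≤ -[1+ 2 ])
outside01-cases (+ 0)                 a∉01 = ⊥-elim (a∉01 (inj₁ refl))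
outside01-cases (+ 1)                 a∉01 = ⊥-elim (a∉01 (inj₂ refl))
outside01-cases (+ 2)                 _    = inj₁ (inj₂ (inj₂ (inj₁ refl)))
outside01-cases (+ 3)                 _    = inj₁ (inj₂ (inj₂ (inj₂ refl)))
outside01-cases (+ ℕ.suc (ℕ.suc (ℕ.suc (ℕ.suc n)))) _ =
  inj₂ (inj₁ (ℤ.+≤+ (s≤s (s≤s (s≤s (s≤s z≤n))))))
outside01-cases -[1+ 0 ]              _    = inj₁ (inj₂ (inj₁ refl))
outside01-cases -[1+ 1 ]              _    = inj₁ (inj₁ refl)
outside01-cases -[1+ ℕ.suc (ℕ.suc n) ] _   = inj₂ (inj₂ (ℤ.-≤- (s≤s (s≤s z≤n))))

-- In the next four lemmas p = (0,t), q = (A,L) and r = (1,B) are points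
-- of conv(V), with t and L in [0,1] as far as needed; each lemma names
-- nonnegative weights α, β, γ of p, q, r whose combination is the claimed
-- lattice point, and the two coordinate identities are ring identities.

-- A ≥ 1, B > 1: the segment pq meets x = 1 at height ≤ 1 < B.
conv∋[1,1] : ∀ {n} (V : Vec Pt n) {t A L B : ℚ} →
  InConv V (0ℚ , t) → InConv V (A , L) → InConv V (1ℚ , B) →
  t ℚ.≤ 1ℚ → L ℚ.≤ 1ℚ → 1ℚ ℚ.≤ A → 1ℚ ℚ.< B →
  InConv V (embed (+ 1 , + 1))
conv∋[1,1] V {t} {A} {L} {B} p q r t≤1 L≤1 1≤A 1<B =
  let α = (A - 1ℚ) * (B - 1ℚ)
      β = B - 1ℚ
      γ = (A - 1ℚ) * (1ℚ - t) + (1ℚ - L)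
      0≤α = 0≤* (0≤- 1≤A) (ℚ.<⇒≤ (0<- 1<B))
      0≤γ = 0≤+ (0≤* (0≤- 1≤A) (0≤- t≤1)) (0≤- L≤1)
  in convexCombination₃ V α β γ 0≤α (ℚ.<⇒≤ (0<- 1<B)) 0≤γ (0<-middle 0≤α (0<- 1<B) 0≤γ)
       p q r (solve (t ∷ A ∷ L ∷ B ∷ []) ℚ-ring) (solve (t ∷ A ∷ L ∷ B ∷ []) ℚ-ring)

-- A ≥ 1, B < 0: the segment pq meets x = 1 at height ≥ 0 > B.
conv∋[1,0] : ∀ {n} (V : Vec Pt n) {t A L B : ℚ} →
  InConv V (0ℚ , t) → InConv V (A , L) → InConv V (1ℚ , B) →
  0ℚ ℚ.≤ t → 0ℚ ℚ.≤ L → 1ℚ ℚ.≤ A → B ℚ.< 0ℚ →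
  InConv V (embed (+ 1 , + 0))
conv∋[1,0] V {t} {A} {L} {B} p q r 0≤t 0≤L 1≤A B<0 =
  let 0<-B = ℚ.neg-antimono-< B<0
      α = (A - 1ℚ) * (- B)
      β = - B
      γ = (A - 1ℚ) * t + L
      0≤α = 0≤* (0≤- 1≤A) (ℚ.<⇒≤ 0<-B)
      0≤γ = 0≤+ (0≤* (0≤- 1≤A) 0≤t) 0≤L
  in convexCombination₃ V α β γ 0≤α (ℚ.<⇒≤ 0<-B) 0≤γ (0<-middle 0≤α 0<-B 0≤γ)
       p q r (solve (t ∷ A ∷ L ∷ B ∷ []) ℚ-ring) (solve (t ∷ A ∷ L ∷ B ∷ []) ℚ-ring)

-- A ≤ -1, B ≥ 4: the segment qr meets x = 0 at height ≥ 2 > t.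
conv∋[0,2] : ∀ {n} (V : Vec Pt n) {t A L B : ℚ} →
  InConv V (0ℚ , t) → InConv V (A , L) → InConv V (1ℚ , B) →
  t ℚ.≤ 1ℚ → 0ℚ ℚ.≤ L → A ℚ.≤ - 1ℚ → toℚ (+ 4) ℚ.≤ B →
  InConv V (embed (+ 0 , + 2))
conv∋[0,2] V {t} {A} {L} {B} p q r t≤1 0≤L A≤-1 4≤B =
  let K = - 1ℚ - A
      M = B - toℚ (+ 4)
      0≤K = 0≤- A≤-1
      0≤M = 0≤- 4≤B
      0<β = ℚ.+-mono-<-≤ 0<1 (0≤- t≤1)
      α = L + M + K * M + (1ℚ + 1ℚ) * K
      β = 1ℚ + (1ℚ - t)
      γ = β * (1ℚ + K)
      0≤α = 0≤+ (0≤+ (0≤+ 0≤L 0≤M) (0≤* 0≤K 0≤M)) (0≤* (0≤+ 0≤1 0≤1) 0≤K)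
      0≤γ = 0≤* (ℚ.<⇒≤ 0<β) (0≤+ 0≤1 0≤K)
  in convexCombination₃ V α β γ 0≤α (ℚ.<⇒≤ 0<β) 0≤γ (0<-middle 0≤α 0<β 0≤γ)
       p q r (solve (t ∷ A ∷ L ∷ B ∷ []) ℚ-ring) (solve (t ∷ A ∷ L ∷ B ∷ []) ℚ-ring)

-- A ≤ -1, B ≤ -3: the segment qr meets x = 0 at height ≤ -1 < t.
conv∋[0,-1] : ∀ {n} (V : Vec Pt n) {t A L B : ℚ} →
  InConv V (0ℚ , t) → InConv V (A , L) → InConv V (1ℚ , B) →
  0ℚ ℚ.≤ t → L ℚ.≤ 1ℚ → A ℚ.≤ - 1ℚ → B ℚ.≤ - toℚ (+ 3) →
  InConv V (embed (+ 0 , -[1+ 0 ]))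
conv∋[0,-1] V {t} {A} {L} {B} p q r 0≤t L≤1 A≤-1 B≤-3 =
  let K = - 1ℚ - A
      M = - toℚ (+ 3) - B
      0≤K = 0≤- A≤-1
      0≤M = 0≤- B≤-3
      0<β = ℚ.+-mono-<-≤ 0<1 0≤t
      α = (1ℚ - L) + M + K * M + (1ℚ + 1ℚ) * K
      β = 1ℚ + t
      γ = β * (1ℚ + K)
      0≤α = 0≤+ (0≤+ (0≤+ (0≤- L≤1) 0≤M) (0≤* 0≤K 0≤M)) (0≤* (0≤+ 0≤1 0≤1) 0≤K)
      0≤γ = 0≤* (ℚ.<⇒≤ 0<β) (0≤+ 0≤1 0≤K)
  in convexCombination₃ V α β γ 0≤α (ℚ.<⇒≤ 0<β) 0≤γ (0<-middle 0≤α 0<β 0≤γ)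
       p q r (solve (t ∷ A ∷ L ∷ B ∷ []) ℚ-ring) (solve (t ∷ A ∷ L ∷ B ∷ []) ℚ-ring)

axisPoint∉conv : ∀ {n} (V : Vec Pt n) {a₁ λ′ a₂ c : ℤ} →
  (∀ (z : Pt) → (InConv V (embed z) × ¬ InUnitSquare z) → (z ≡ (a₁ , λ′) ⊎ z ≡ (+ 1 , a₂))) →
  a₁ ≢ + 0 → ¬ Is01 c → ¬ InConv V (embed (+ 0 , c))
axisPoint∉conv V outer a₁≢0 c∉01 [0,c]∈P with outer _ ([0,c]∈P , λ (_ , c∈01) → c∉01 c∈01)
... | inj₁ [0,c]≡v₁ = a₁≢0 (sym (cong proj₁ [0,c]≡v₁))
... | inj₂ ()

lemma8 : ∀ {n} (V : Vec Pt n) (v1 v2 : Pt) →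
    Boxed V v1 v2 →
    (∃ λ t → 0ℚ ℚ.≤ t × t ℚ.≤ 1ℚ × InConv V (0ℚ , t)) →
    ¬ InConv V (embed (+ 1 , + 0)) →
    ¬ InConv V (embed (+ 1 , + 1)) →
    ∀ (a2 : ℤ) → v2 ≡ (+ 1 , a2) →
    (a2 ≡ -[1+ 1 ] ⊎ a2 ≡ -[1+ 0 ] ⊎ a2 ≡ + 2 ⊎ a2 ≡ + 3)
lemma8 V (a₁ , l) _ (_ , outer , v₁∈P , _ , v₂∈P , _ , a₁∉01 , l∈01 , _ , a₂∉01)
       (t , 0≤t , t≤1 , p∈P) [1,0]∉P [1,1]∉P a₂ refl =
  conclude (outside01-cases a₂ a₂∉01) (nonzero-sign a₁≢0)
  where
  a₁≢0 : a₁ ≢ + 0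
  a₁≢0 a₁≡0 = a₁∉01 (inj₁ a₁≡0)

  0≤L : 0ℚ ℚ.≤ toℚ l
  0≤L = toℚ-mono-≤ (proj₁ (Is01⇒bounds l∈01))

  L≤1 : toℚ l ℚ.≤ 1ℚ
  L≤1 = toℚ-mono-≤ (proj₂ (Is01⇒bounds l∈01))

  conclude : (a₂ ≡ -[1+ 1 ] ⊎ a₂ ≡ -[1+ 0 ] ⊎ a₂ ≡ + 2 ⊎ a₂ ≡ + 3) ⊎ (+ 4 ℤ.≤ a₂ ⊎ a₂ ℤ.≤ -[1+ 2 ]) →
             + 1 ℤ.≤ a₁ ⊎ a₁ ℤ.≤ -[1+ 0 ] →
             a₂ ≡ -[1+ 1 ] ⊎ a₂ ≡ -[1+ 0 ] ⊎ a₂ ≡ + 2 ⊎ a₂ ≡ + 3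
  conclude (inj₁ a₂-allowed)   _          = a₂-allowed
  conclude (inj₂ (inj₁ 4≤a₂))  (inj₁ 1≤a₁) =
    ⊥-elim ([1,1]∉P (conv∋[1,1] V p∈P v₁∈P v₂∈P t≤1 L≤1 (toℚ-mono-≤ 1≤a₁)
                       (toℚ-mono-< (ℤ.<-≤-trans (ℤ.+<+ (s≤s (s≤s z≤n))) 4≤a₂))))
  conclude (inj₂ (inj₂ a₂≤-3)) (inj₁ 1≤a₁) =
    ⊥-elim ([1,0]∉P (conv∋[1,0] V p∈P v₁∈P v₂∈P 0≤t 0≤L (toℚ-mono-≤ 1≤a₁)
                       (toℚ-mono-< (ℤ.≤-<-trans a₂≤-3 (ℤ.-<+ {n = 0})))))
  conclude (inj₂ (inj₁ 4≤a₂))  (inj₂ a₁≤-1) =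
    ⊥-elim (axisPoint∉conv V {c = + 2} outer a₁≢0 (λ { (inj₁ ()) ; (inj₂ ()) })
              (conv∋[0,2] V p∈P v₁∈P v₂∈P t≤1 0≤L (toℚ-mono-≤ a₁≤-1) (toℚ-mono-≤ 4≤a₂)))
  conclude (inj₂ (inj₂ a₂≤-3)) (inj₂ a₁≤-1) =
    ⊥-elim (axisPoint∉conv V {c = -[1+ 0 ]} outer a₁≢0 (λ { (inj₁ ()) ; (inj₂ ()) })
              (conv∋[0,-1] V p∈P v₁∈P v₂∈P 0≤t L≤1 (toℚ-mono-≤ a₁≤-1) (toℚ-mono-≤ a₂≤-3)))
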